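{- Let $m\geq1$ and $k\geq2$ be integers, and let $H$ be an $m$-connected, $(n-km+2m-1)$-closed graph of order $n\geq(7k-2)m+4$. If $$e(H)\geq\binom{n-(k-1)m-2}{2}+(k-1)m^2+(k+1)m+3,$$ then $\omega(H)\geq n-(k-1)m-1$.
   Context: All graphs are finite and simple; $e(H)$ is the number of edges and $\omega(H)$ the clique number. A graph $H$ is $l$-closed if every pair of nonadjacent vertices $u,v$ satisfies $d_H(u)+d_H(v)<l$ (equivalently, $H$ equals its own $l$-closure). -}

module Defs where

open import Data.Bool using (Bool; true; false; if_then_else_; _∧_)
open import Data.Nat using (ℕ; zero; suc; _+_; _<_; _≤_; _<ᵇ_)
open import Data.Fin using (Fin; toℕ)
open import Data.Fin.Subset using (Subset; _∈_; _∉_; ∣_∣)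
open import Data.List using (List; map; allFin)
open import Data.Nat.ListAction using (sum)
open import Data.Product using (Σ; _×_; ∃-syntax)
open import Relation.Binary.PropositionalEquality using (_≡_)
open import Relation.Nullary using (¬_)

record Graph (n : ℕ) : Set where
  field
    adj   : Fin n → Fin n → Bool
    sym   : ∀ u v → adj u v ≡ adj v u
    irrfl : ∀ v → adj v v ≡ false
open Graph public

Adjacent : ∀ {n} → Graph n → Fin n → Fin n → Set
Adjacent H u v = adj H u v ≡ true

b2n : Bool → ℕ
b2n true  = 1
b2n false = 0

deg : ∀ {n} → Graph n → Fin n → ℕ
deg {n} H v = sum (map (λ w → b2n (adj H v w)) (allFin n))

edges : ∀ {n} → Graph n → ℕ
edges {n} H =
  sum (map (λ u → sum (map (λ w → b2n ((toℕ u <ᵇ toℕ w) ∧ adj H u w)) (allFin n)))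
           (allFin n))

Closed : ∀ {n} → ℕ → Graph n → Set
Closed {n} l H = ∀ (u v : Fin n) → ¬ (u ≡ v) → ¬ Adjacent H u v → deg H u + deg H v < l

data Reach {n} (H : Graph n) (S : Subset n) : Fin n → Fin n → Set where
  here : ∀ {u} → u ∉ S → Reach H S u u
  step : ∀ {u v w} → u ∉ S → Adjacent H u v → Reach H S v w → Reach H S u w

Connected : ∀ {n} → ℕ → Graph n → Set
Connected {n} m H =
  m < n × (∀ (S : Subset n) → ∣ S ∣ < m →
             ∀ (u v : Fin n) → u ∉ S → v ∉ S → Reach H S u v)

IsClique : ∀ {n} → Graph n → Subset n → Set
IsClique H K = ∀ u v → u ∈ K → v ∈ K → ¬ (u ≡ v) → Adjacent H u v

CliqueNumberAtLeast : ∀ {n} → Graph n → ℕ → Set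
CliqueNumberAtLeast H t = ∃[ K ] (IsClique H K × t ≤ ∣ K ∣)

-- Write T = n - (k-1)m - 2, so the clique sought has order T + 1 and H is (T + m + 1)-closed.
-- Pick the threshold q for which at least T + 1 vertices have degree ≥ q but at most T have
-- degree ≥ q + 1. If 2q ≥ T + m + 1, closedness makes the vertices of degree ≥ q a clique.
-- Otherwise some vertex w has degree exactly q, and closedness forces every vertex of degree
-- ≥ T + m + 1 - q to be a neighbour of w, so there are at most q of them. Summing degrees under
-- these constraints bounds 2e(H) strictly below twice the assumed bound: for q ≤ m by splitting
-- the degree sum over the at most T high-degree vertices and the rest, for q > m by bounding
-- every degree by its level.

module Submission where

import Algebra.Properties.Semiring.Sum
open import Data.Bool using (Bool; true; false; not; _∧_)
open import Data.Bool.Properties using (not-¬)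
open import Data.Empty using (⊥-elim)
open import Data.Fin using (Fin; zero; suc; toℕ)
open import Data.Fin.Properties using (toℕ-injective)
open import Data.Fin.Subset using (_∈_; ∣_∣)
open import Data.List using (map; allFin) renaming (tabulate to tabulateᴸ)
open import Data.List.Properties using (map-tabulate)
open import Data.Nat
open import Data.Nat.Combinatorics using (_C_; nC1≡n; nCk+nC[k+1]≡[n+1]C[k+1])
open import Data.Nat.ListAction using () renaming (sum to sumᴸ)
open import Data.Nat.Properties
open import Data.Nat.Tactic.RingSolver using (solve-∀)
open import Data.Product using (∃-syntax; _×_; _,_; proj₁; proj₂)
open import Data.Vec using (tabulate)
open import Data.Vec.Properties using ([]=⇒lookup; lookup∘tabulate)
open import Function using (_∘_; id)
open import Relation.Binary.PropositionalEquality
open import Relation.Nullary using (¬_; Dec; yes; no; Reflects; ofʸ; ofⁿ; invert)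

open import Defs hiding (sym)
open import Algebra.Properties.CommutativeSemigroup *-commutativeSemigroup using (x∙yz≈y∙xz)
open Algebra.Properties.Semiring.Sum +-*-semiring

∑-const : ∀ n c → ∑[ i < n ] c ≡ n * c
∑-const zero    c = refl
∑-const (suc n) c = cong (c +_) (∑-const n c)

∑-mono-≤ : ∀ {n} {f g : Fin n → ℕ} → (∀ i → f i ≤ g i) → sum f ≤ sum g
∑-mono-≤ {zero}  f≤g = z≤n
∑-mono-≤ {suc n} f≤g = +-mono-≤ (f≤g zero) (∑-mono-≤ (f≤g ∘ suc))

∑-mono-< : ∀ {n} {f g : Fin n → ℕ} → (∀ i → f i ≤ g i) → ∀ j → f j < g j → sum f < sum g
∑-mono-< f≤g zero    fj<gj = +-mono-<-≤ fj<gj (∑-mono-≤ (f≤g ∘ suc))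
∑-mono-< f≤g (suc j) fj<gj = +-mono-≤-< (f≤g zero) (∑-mono-< (f≤g ∘ suc) j fj<gj)

∑-<⇒∃< : ∀ {n} {f g : Fin n → ℕ} → sum f < sum g → ∃[ i ] f i < g i
∑-<⇒∃< {suc n} {f} {g} ∑f<∑g with f zero <? g zero
... | yes f₀<g₀ = zero , f₀<g₀
... | no  f₀≮g₀ with ∑-<⇒∃< {f = f ∘ suc} {g ∘ suc} tail<
  where
  tail< : sum (f ∘ suc) < sum (g ∘ suc)
  tail< = +-cancelˡ-< (f zero) _ _ (<-≤-trans ∑f<∑g (+-monoˡ-≤ _ (≮⇒≥ f₀≮g₀)))
... | i , fi<gi = suc i , fi<gi

sumᴸ-tabulate : ∀ {n} (f : Fin n → ℕ) → sumᴸ (tabulateᴸ f) ≡ sum f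
sumᴸ-tabulate {zero}  f = refl
sumᴸ-tabulate {suc n} f = cong (f zero +_) (sumᴸ-tabulate (f ∘ suc))

sumᴸ-allFin : ∀ {n} (f : Fin n → ℕ) → sumᴸ (map f (allFin n)) ≡ sum f
sumᴸ-allFin f = trans (cong sumᴸ (map-tabulate id f)) (sumᴸ-tabulate f)

<⇒≤∸1 : ∀ {m n} → m < n → m ≤ n ∸ 1
<⇒≤∸1 (s≤s m≤n) = m≤n

b2n≤1 : ∀ b → b2n b ≤ 1
b2n≤1 true  = ≤-refl
b2n≤1 false = z≤n

b2n+b2n-not : ∀ b → b2n b + b2n (not b) ≡ 1
b2n+b2n-not true  = refl
b2n+b2n-not false = refl

b2n-*-split : ∀ b x → x ≡ b2n b * x + b2n (not b) * x
b2n-*-split true  x = sym (trans (+-identityʳ (x + 0)) (+-identityʳ x))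
b2n-*-split false x = sym (+-identityʳ x)

module _ {n : ℕ} where

  count : (Fin n → Bool) → ℕ
  count p = ∑[ i < n ] b2n (p i)

  sumOver : (Fin n → Bool) → (Fin n → ℕ) → ℕ
  sumOver p f = ∑[ i < n ] (b2n (p i) * f i)

  count+count-not : ∀ p → count p + count (not ∘ p) ≡ n
  count+count-not p = begin
    count p + count (not ∘ p)        ≡⟨ ∑-distrib-+ (b2n ∘ p) (b2n ∘ not ∘ p) ⟨
    ∑[ i < n ] (b2n (p i) + b2n (not (p i))) ≡⟨ sum-cong-≗ (b2n+b2n-not ∘ p) ⟩
    ∑[ i < n ] 1                     ≡⟨ ∑-const n 1 ⟩
    n * 1                            ≡⟨ *-identityʳ n ⟩
    n                                ∎
    where open ≡-Reasoning

  ∑-split : ∀ p f → sum f ≡ sumOver p f + sumOver (not ∘ p) f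
  ∑-split p f = trans (sum-cong-≗ (λ i → b2n-*-split (p i) (f i)))
                      (∑-distrib-+ (λ i → b2n (p i) * f i) (λ i → b2n (not (p i)) * f i))

  sumOver-+ : ∀ p f g → sumOver p (λ i → f i + g i) ≡ sumOver p f + sumOver p g
  sumOver-+ p f g = trans (sum-cong-≗ (λ i → *-distribˡ-+ (b2n (p i)) (f i) (g i)))
                          (∑-distrib-+ (λ i → b2n (p i) * f i) (λ i → b2n (p i) * g i))

  sumOver-mono-≤ : ∀ p {f g} → (∀ i → f i ≤ g i) → sumOver p f ≤ sumOver p g
  sumOver-mono-≤ p f≤g = ∑-mono-≤ (λ i → *-monoʳ-≤ (b2n (p i)) (f≤g i))

  sumOver≤count* : ∀ p {f} c → (∀ i → p i ≡ true → f i ≤ c) → sumOver p f ≤ count p * c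
  sumOver≤count* p {f} c f≤c = begin
    sumOver p f               ≤⟨ ∑-mono-≤ bound ⟩
    ∑[ i < n ] (b2n (p i) * c) ≡⟨ *-distribʳ-sum c (b2n ∘ p) ⟨
    count p * c               ∎
    where
    open ≤-Reasoning
    bound : ∀ i → b2n (p i) * f i ≤ b2n (p i) * c
    bound i with p i in eq
    ... | true  = +-monoˡ-≤ 0 (f≤c i eq)
    ... | false = z≤n

  count-<⇒∃ : ∀ p q → count p < count q → ∃[ i ] q i ≡ true × p i ≡ false
  count-<⇒∃ p q cp<cq with ∑-<⇒∃< cp<cq
  ... | i , pi<qi with p i in pᵢ | q i in qᵢ
  ...   | false | true = i , qᵢ , pᵢ
  ...   | false | false = ⊥-elim (<-irrefl refl pi<qi)
  ...   | true  | b     = ⊥-elim (<⇒≱ pi<qi (b2n≤1 b))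

∣tabulate∣≡count : ∀ {n} (p : Fin n → Bool) → ∣ tabulate p ∣ ≡ count p
∣tabulate∣≡count {zero}  p = refl
∣tabulate∣≡count {suc n} p with p zero
... | true  = cong suc (∣tabulate∣≡count (p ∘ suc))
... | false = ∣tabulate∣≡count (p ∘ suc)

∈tabulate⇒ : ∀ {n} {p : Fin n → Bool} {i} → i ∈ tabulate p → p i ≡ true
∈tabulate⇒ {p = p} {i} i∈p = trans (sym (lookup∘tabulate p i)) ([]=⇒lookup i∈p)

∃-boundary : ∀ {P : ℕ → Set} → (∀ j → Dec (P j)) → P 0 → ∀ N → ¬ P N → ∃[ j ] P j × ¬ P (suc j)
∃-boundary P? p₀ zero    ¬pN = ⊥-elim (¬pN p₀)
∃-boundary P? p₀ (suc N) ¬pN with P? N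
... | yes pN  = N , pN , ¬pN
... | no  ¬pN′ = ∃-boundary P? p₀ N ¬pN′

module _ {n : ℕ} where

  atLeast : ℕ → (Fin n → ℕ) → Fin n → Bool
  atLeast j f i = j ≤ᵇ f i

  atLeast-reflects : ∀ j f i → Reflects (j ≤ f i) (atLeast j f i)
  atLeast-reflects j f i = ≤ᵇ-reflects-≤ j (f i)

  atLeast⇒≤ : ∀ {j} f i → atLeast j f i ≡ true → j ≤ f i
  atLeast⇒≤ {j} f i eq = invert (subst (Reflects (j ≤ f i)) eq (atLeast-reflects j f i))

  atLeast⇒≰ : ∀ {j} f i → atLeast j f i ≡ false → j ≰ f i
  atLeast⇒≰ {j} f i eq = invert (subst (Reflects (j ≤ f i)) eq (atLeast-reflects j f i))

  count-atLeast-0 : ∀ f → count (atLeast 0 f) ≡ n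
  count-atLeast-0 f = trans (∑-const n 1) (*-identityʳ n)

  count-atLeast-≡0 : ∀ {j} f → (∀ i → f i < j) → count (atLeast j f) ≡ 0
  count-atLeast-≡0 {j} f f<j = trans (sum-cong-≗ absent) (trans (∑-const n 0) (*-zeroʳ n))
    where
    absent : ∀ i → b2n (atLeast j f i) ≡ 0
    absent i with atLeast j f i | atLeast-reflects j f i
    ... | true  | ofʸ j≤fi = ⊥-elim (<⇒≱ (f<j i) j≤fi)
    ... | false | ofⁿ _    = refl

  count-atLeast-drop⇒∃ : ∀ f q → count (atLeast (suc q) f) < count (atLeast q f) → ∃[ w ] f w ≡ q
  count-atLeast-drop⇒∃ f q drop with count-<⇒∃ (atLeast (suc q) f) (atLeast q f) drop
  ... | w , q≤fw , q+1≰fw = w , ≤-antisym (≤-pred (≰⇒> (atLeast⇒≰ f w q+1≰fw))) (atLeast⇒≤ f w q≤fw)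

  sumOver-atMost : ∀ f q → sumOver (not ∘ atLeast (suc q) f) f ≤ count (not ∘ atLeast (suc q) f) * q
  sumOver-atMost f q = sumOver≤count* (not ∘ atLeast (suc q) f) q fi≤q
    where
    fi≤q : ∀ i → not (atLeast (suc q) f i) ≡ true → f i ≤ q
    fi≤q i low with atLeast (suc q) f i in high
    fi≤q i refl | false = ≤-pred (≰⇒> (atLeast⇒≰ f i high))

  ∑-three-levels : ∀ f a t c → (∀ i → f i ≤ a + t + c) →
    sum f + count (not ∘ atLeast (suc a) f) * t ≤ n * (a + t) + count (atLeast (suc (a + t)) f) * c
  ∑-three-levels f a t c f≤ = begin
    sum f + count low * t
      ≡⟨ cong (sum f +_) (*-distribʳ-sum t (b2n ∘ low)) ⟩
    sum f + ∑[ i < n ] (b2n (low i) * t)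
      ≡⟨ ∑-distrib-+ f (λ i → b2n (low i) * t) ⟨
    ∑[ i < n ] (f i + b2n (low i) * t)
      ≤⟨ ∑-mono-≤ pointwise ⟩
    ∑[ i < n ] (a + t + b2n (high i) * c)
      ≡⟨ ∑-distrib-+ (λ _ → a + t) (λ i → b2n (high i) * c) ⟩
    ∑[ i < n ] (a + t) + ∑[ i < n ] (b2n (high i) * c)
      ≡⟨ cong₂ _+_ (∑-const n (a + t)) (sym (*-distribʳ-sum c (b2n ∘ high))) ⟩
    n * (a + t) + count high * c ∎
    where
    open ≤-Reasoning
    low high : Fin n → Bool
    low  = not ∘ atLeast (suc a) f
    high = atLeast (suc (a + t)) f
    pointwise : ∀ i → f i + b2n (low i) * t ≤ a + t + b2n (high i) * c
    pointwise i with atLeast (suc a) f i | atLeast-reflects (suc a) f i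
                   | atLeast (suc (a + t)) f i | atLeast-reflects (suc (a + t)) f i
    ... | true  | ofʸ _    | true  | ofʸ _ =
      subst₂ _≤_ (sym (+-identityʳ (f i))) (cong (a + t +_) (sym (+-identityʳ c))) (f≤ i)
    ... | true  | ofʸ _    | false | ofⁿ a+t≮fi =
      +-monoˡ-≤ 0 (≤-pred (≰⇒> a+t≮fi))
    ... | false | ofⁿ a≮fi | false | ofⁿ _ =
      subst (f i + (t + 0) ≤_) (sym (+-assoc a t 0)) (+-monoˡ-≤ (t + 0) (≤-pred (≰⇒> a≮fi)))
    ... | false | ofⁿ a≮fi | true  | ofʸ a+t<fi =
      ⊥-elim (a≮fi (≤-trans (s≤s (m≤m+n a t)) a+t<fi))

module _ {n : ℕ} (H : Graph n) where

  adjᴺ : Fin n → Fin n → ℕ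
  adjᴺ v w = b2n (adj H v w)

  deg≡∑ : ∀ v → deg H v ≡ ∑[ w < n ] adjᴺ v w
  deg≡∑ v = sumᴸ-allFin (adjᴺ v)

  deg<n : ∀ v → deg H v < n
  deg<n v = begin-strict
    deg H v            ≡⟨ deg≡∑ v ⟩
    ∑[ w < n ] adjᴺ v w <⟨ ∑-mono-< (λ w → b2n≤1 (adj H v w)) v no-loop ⟩
    ∑[ w < n ] 1        ≡⟨ ∑-const n 1 ⟩
    n * 1              ≡⟨ *-identityʳ n ⟩
    n                  ∎
    where
    open ≤-Reasoning
    no-loop : adjᴺ v v < 1
    no-loop rewrite irrfl H v = s≤s z≤n

  handshake : sum (deg H) ≡ edges H + edges H
  handshake = begin
    sum (deg H)                                        ≡⟨ sum-cong-≗ deg≡∑ ⟩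
    ∑[ u < n ] ∑[ w < n ] adjᴺ u w                     ≡⟨ sum-cong-≗ (λ u → trans (sum-cong-≗ (adj-split u))
                                                                               (∑-distrib-+ (up u) (λ w → up w u))) ⟩
    ∑[ u < n ] (∑[ w < n ] up u w + ∑[ w < n ] up w u) ≡⟨ ∑-distrib-+ (λ u → ∑[ w < n ] up u w) _ ⟩
    ∑∑up + ∑[ u < n ] ∑[ w < n ] up w u                ≡⟨ cong (∑∑up +_) (∑-comm (λ u w → up w u)) ⟩
    ∑∑up + ∑∑up                                        ≡⟨ cong₂ _+_ edges≡∑∑up edges≡∑∑up ⟨
    edges H + edges H                                  ∎
    where
    open ≡-Reasoning
    up : Fin n → Fin n → ℕ
    up u w = b2n ((toℕ u <ᵇ toℕ w) ∧ adj H u w)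
    ∑∑up : ℕ
    ∑∑up = ∑[ u < n ] ∑[ w < n ] up u w
    edges≡∑∑up : edges H ≡ ∑∑up
    edges≡∑∑up = trans (sumᴸ-allFin (λ u → sumᴸ (map (up u) (allFin n)))) (sum-cong-≗ (λ u → sumᴸ-allFin (up u)))
    adj-split : ∀ u w → adjᴺ u w ≡ up u w + up w u
    adj-split u w with toℕ u <ᵇ toℕ w | <ᵇ-reflects-< (toℕ u) (toℕ w)
                     | toℕ w <ᵇ toℕ u | <ᵇ-reflects-< (toℕ w) (toℕ u)
    ... | true  | ofʸ u<w | true  | ofʸ w<u = ⊥-elim (<-asym u<w w<u)
    ... | true  | _       | false | _       = sym (+-identityʳ (adjᴺ u w))
    ... | false | _       | true  | _       = cong b2n (Graph.sym H u w)
    ... | false | ofⁿ u≮w | false | ofⁿ w≮u rewrite toℕ-injective (≤-antisym (≮⇒≥ w≮u) (≮⇒≥ u≮w)) =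
      cong b2n (irrfl H w)

  degIn : (Fin n → Bool) → Fin n → ℕ
  degIn p v = sumOver p (adjᴺ v)

  deg≡degIn+degIn : ∀ p v → deg H v ≡ degIn p v + degIn (not ∘ p) v
  deg≡degIn+degIn p v = trans (deg≡∑ v) (∑-split p (adjᴺ v))

  degIn≤deg : ∀ p v → degIn p v ≤ deg H v
  degIn≤deg p v = subst (degIn p v ≤_) (sym (deg≡degIn+degIn p v)) (m≤m+n _ _)

  degIn<count : ∀ p v → p v ≡ true → degIn p v < count p
  degIn<count p v pv = ∑-mono-< ≤b2n v self
    where
    ≤b2n : ∀ w → b2n (p w) * adjᴺ v w ≤ b2n (p w)
    ≤b2n w = subst (b2n (p w) * adjᴺ v w ≤_) (*-identityʳ (b2n (p w))) (*-monoʳ-≤ (b2n (p w)) (b2n≤1 (adj H v w)))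
    self : b2n (p v) * adjᴺ v v < b2n (p v)
    self rewrite pv | irrfl H v = s≤s z≤n

  sumOver-degIn-comm : ∀ p q → sumOver p (degIn q) ≡ sumOver q (degIn p)
  sumOver-degIn-comm p q = begin
    ∑[ v < n ] (b2n (p v) * ∑[ w < n ] (b2n (q w) * adjᴺ v w))
      ≡⟨ sum-cong-≗ (λ v → *-distribˡ-sum (b2n (p v)) (λ w → b2n (q w) * adjᴺ v w)) ⟩
    ∑[ v < n ] ∑[ w < n ] (b2n (p v) * (b2n (q w) * adjᴺ v w))
      ≡⟨ ∑-comm (λ v w → b2n (p v) * (b2n (q w) * adjᴺ v w)) ⟩
    ∑[ w < n ] ∑[ v < n ] (b2n (p v) * (b2n (q w) * adjᴺ v w))
      ≡⟨ sum-cong-≗ (λ w → sum-cong-≗ (λ v → swap v w)) ⟩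
    ∑[ w < n ] ∑[ v < n ] (b2n (q w) * (b2n (p v) * adjᴺ w v))
      ≡⟨ sum-cong-≗ (λ w → *-distribˡ-sum (b2n (q w)) (λ v → b2n (p v) * adjᴺ w v)) ⟨
    ∑[ w < n ] (b2n (q w) * ∑[ v < n ] (b2n (p v) * adjᴺ w v))
      ∎
    where
    open ≡-Reasoning
    swap : ∀ v w → b2n (p v) * (b2n (q w) * adjᴺ v w) ≡ b2n (q w) * (b2n (p v) * adjᴺ w v)
    swap v w = trans (x∙yz≈y∙xz (b2n (p v)) (b2n (q w)) (adjᴺ v w))
                     (cong (λ b → b2n (q w) * (b2n (p v) * b2n b)) (Graph.sym H v w))

  ∑deg≤ : ∀ p → sum (deg H) ≤ count p * (count p ∸ 1) + 2 * sumOver (not ∘ p) (deg H)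
  ∑deg≤ p = begin
    sum (deg H)                                            ≡⟨ ∑-split p (deg H) ⟩
    sumOver p (deg H) + outside                            ≡⟨ cong (_+ outside) inside-split ⟩
    sumOver p (degIn p) + sumOver p (degIn p̄) + outside    ≤⟨ +-monoˡ-≤ outside (+-mono-≤ within across) ⟩
    count p * (count p ∸ 1) + outside + outside            ≡⟨ regroup (count p * (count p ∸ 1)) outside ⟩
    count p * (count p ∸ 1) + 2 * outside                  ∎
    where
    open ≤-Reasoning
    p̄ : Fin n → Bool
    p̄ = not ∘ p
    outside : ℕ
    outside = sumOver p̄ (deg H)
    inside-split : sumOver p (deg H) ≡ sumOver p (degIn p) + sumOver p (degIn p̄)
    inside-split = trans (sum-cong-≗ (λ v → cong (b2n (p v) *_) (deg≡degIn+degIn p v)))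
                         (sumOver-+ p (degIn p) (degIn p̄))
    within : sumOver p (degIn p) ≤ count p * (count p ∸ 1)
    within = sumOver≤count* p (count p ∸ 1) (λ v pv → <⇒≤∸1 (degIn<count p v pv))
    across : sumOver p (degIn p̄) ≤ outside
    across = ≤-trans (≤-reflexive (sumOver-degIn-comm p p̄)) (sumOver-mono-≤ p̄ (degIn≤deg p))
    regroup : ∀ a b → a + b + b ≡ a + 2 * b
    regroup = solve-∀

module _ {n l : ℕ} (H : Graph n) (closed : Closed l H) where

  atLeast-isClique : ∀ q → l ≤ q + q → IsClique H (tabulate (atLeast q (deg H)))
  atLeast-isClique q l≤q+q u v u∈ v∈ u≢v with adj H u v in uv
  ... | true  = refl
  ... | false = ⊥-elim (<⇒≱ (closed u v u≢v (not-¬ uv)) (≤-trans l≤q+q (+-mono-≤ (q≤deg u∈) (q≤deg v∈))))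
    where
    q≤deg : ∀ {x} → x ∈ tabulate (atLeast q (deg H)) → q ≤ deg H x
    q≤deg {x} x∈ = atLeast⇒≤ (deg H) x (∈tabulate⇒ x∈)

  count-atLeast≤deg : ∀ w j → l ≤ deg H w + j → deg H w < j → count (atLeast j (deg H)) ≤ deg H w
  count-atLeast≤deg w j l≤ deg<j = begin
    count (atLeast j (deg H)) ≤⟨ ∑-mono-≤ high⇒adjacent ⟩
    ∑[ v < n ] adjᴺ H w v     ≡⟨ deg≡∑ H w ⟨
    deg H w                   ∎
    where
    open ≤-Reasoning
    high⇒adjacent : ∀ v → b2n (atLeast j (deg H) v) ≤ adjᴺ H w v
    high⇒adjacent v with atLeast j (deg H) v in high | adj H w v in wv
    ... | false | _     = z≤n
    ... | true  | true  = ≤-refl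
    ... | true  | false = ⊥-elim (<⇒≱ (closed w v w≢v (not-¬ wv)) (≤-trans l≤ (+-monoʳ-≤ (deg H w) j≤dv)))
      where
      j≤dv : j ≤ deg H v
      j≤dv = atLeast⇒≤ (deg H) v high
      w≢v : w ≢ v
      w≢v refl = <⇒≱ deg<j j≤dv

2*[nC2]≡n*[n∸1] : ∀ a → 2 * (a C 2) ≡ a * (a ∸ 1)
2*[nC2]≡n*[n∸1] zero    = refl
2*[nC2]≡n*[n∸1] (suc a) = begin
  2 * (suc a C 2)          ≡⟨ cong (2 *_) (nCk+nC[k+1]≡[n+1]C[k+1] a 1) ⟨
  2 * (a C 1 + a C 2)      ≡⟨ cong (λ c → 2 * (c + a C 2)) (nC1≡n a) ⟩
  2 * (a + a C 2)          ≡⟨ *-distribˡ-+ 2 a (a C 2) ⟩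
  2 * a + 2 * (a C 2)      ≡⟨ cong (2 * a +_) (2*[nC2]≡n*[n∸1] a) ⟩
  2 * a + a * (a ∸ 1)      ≡⟨ 2a+a[a∸1]≡[1+a]a a ⟩
  suc a * a                ∎
  where
  open ≡-Reasoning
  2a+a[a∸1]≡[1+a]a : ∀ a → 2 * a + a * (a ∸ 1) ≡ suc a * a
  2a+a[a∸1]≡[1+a]a zero    = refl
  2a+a[a∸1]≡[1+a]a (suc b) = identity b
    where
    identity : ∀ b → 2 * suc b + suc b * b ≡ suc (suc b) * suc b
    identity = solve-∀

pairs-gap : ∀ y δ q → 2 * q < y + δ → y * (y ∸ 1) + δ * (2 * q) ≤ (y + δ) * (y + δ ∸ 1)
pairs-gap y zero    q _ = ≤-reflexive (trans (+-identityʳ _) (cong (λ t → t * (t ∸ 1)) (sym (+-identityʳ y))))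
pairs-gap y (suc δ) q 2q<y+δ+1 = begin
  y * (y ∸ 1) + suc δ * (2 * q)   ≤⟨ +-mono-≤ (*-monoʳ-≤ y (m∸n≤m y 1)) (*-monoʳ-≤ (suc δ) 2q≤y+δ) ⟩
  y * y + suc δ * (y + δ)         ≤⟨ +-monoˡ-≤ (suc δ * (y + δ)) (*-monoʳ-≤ y (m≤m+n y δ)) ⟩
  y * (y + δ) + suc δ * (y + δ)   ≡⟨ *-distribʳ-+ (y + δ) y (suc δ) ⟨
  (y + suc δ) * (y + δ)           ≡⟨ cong (λ t → (y + suc δ) * (t ∸ 1)) (+-suc y δ) ⟨
  (y + suc δ) * (y + suc δ ∸ 1)   ∎
  where
  open ≤-Reasoning
  2q≤y+δ : 2 * q ≤ y + δ
  2q≤y+δ = ≤-pred (subst (2 * q <_) (+-suc y δ) 2q<y+δ+1)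

-- Twice the paper's bound binom(T,2) + (k-1)m² + (k+1)m + 3, where s = (k-1)m and T = n - s - 2.
twiceEdgeBound : ℕ → ℕ → ℕ → ℕ
twiceEdgeBound T s m = T * (T ∸ 1) + 2 * ((s + 2) * (m + 1)) + 2

low-threshold-bound : ∀ {m s T q x y E} → q ≤ m → 2 * m < T → y ≤ T → x + y ≡ T + s + 2 →
  E ≤ y * (y ∸ 1) + 2 * (x * q) → E < twiceEdgeBound T s m
low-threshold-bound {m} {s} {T} {q} {x} {y} {E} q≤m 2m<T y≤T x+y≡ E≤ with m≤n⇒∃[o]m+o≡n y≤T
... | δ , refl = begin-strict
  E                                                  ≤⟨ E≤ ⟩
  y * (y ∸ 1) + 2 * (x * q)                          ≡⟨ cong (λ x → y * (y ∸ 1) + 2 * (x * q)) x≡δ+s+2 ⟩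
  y * (y ∸ 1) + 2 * ((δ + s + 2) * q)                ≡⟨ regroup (y * (y ∸ 1)) δ s q ⟩
  y * (y ∸ 1) + δ * (2 * q) + 2 * ((s + 2) * q)      ≤⟨ +-mono-≤ (pairs-gap y δ q 2q<y+δ) (*-monoʳ-≤ 2 (*-monoʳ-≤ (s + 2) q≤m+1)) ⟩
  T * (T ∸ 1) + 2 * ((s + 2) * (m + 1))              <⟨ m<m+n _ (s≤s z≤n) ⟩
  twiceEdgeBound T s m                               ∎
  where
  open ≤-Reasoning
  regroup : ∀ a δ s q → a + 2 * ((δ + s + 2) * q) ≡ a + δ * (2 * q) + 2 * ((s + 2) * q)
  regroup = solve-∀
  x≡δ+s+2 : x ≡ δ + s + 2
  x≡δ+s+2 = +-cancelʳ-≡ y x (δ + s + 2) (trans x+y≡ (reorder y δ s))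
    where
    reorder : ∀ y δ s → y + δ + s + 2 ≡ δ + s + 2 + y
    reorder = solve-∀
  2q<y+δ : 2 * q < y + δ
  2q<y+δ = ≤-<-trans (*-monoʳ-≤ 2 q≤m) 2m<T
  q≤m+1 : q ≤ m + 1
  q≤m+1 = ≤-trans q≤m (m≤m+n m 1)

-- Here q = m + 1 + r and T = 2q + v - m. The bound falls short of twiceEdgeBound by
-- r (r + v - 2m - 2σ - 3) + 2; `balance` is this identity with the subtracted terms moved across,
-- and `room` shows the factor r + v - 2m - 2σ - 3 is nonnegative.
high-threshold-bound′ : ∀ μ σ r v {x z E} →
  let m = suc μ ; s = m + σ ; q = suc m + r ; T = 2 + m + 2 * r + v in
  6 * s + 5 * m + 2 ≤ T → s + 2 ≤ x → z ≤ q →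
  E + x * v ≤ (T + s + 2) * (q + v) + z * (suc σ + q) → E < twiceEdgeBound T s m
high-threshold-bound′ μ σ r v {x} {z} {E} T≥ s+2≤x z≤q E+xv≤ =
  ≤-trans (n≤1+n _) (+-cancelʳ-≤ slack (2 + E) (twiceEdgeBound T s m) (begin
    2 + E + slack                                ≤⟨ +-monoʳ-≤ (2 + E) (+-mono-≤ (*-monoˡ-≤ v s+2≤x) (*-monoʳ-≤ r room)) ⟩
    2 + E + (x * v + r * (r + v))                ≡⟨ +-assoc (2 + E) (x * v) (r * (r + v)) ⟨
    2 + (E + x * v) + r * (r + v)                ≤⟨ +-monoˡ-≤ (r * (r + v)) (+-monoʳ-≤ 2 E+xv≤) ⟩
    2 + (n * (q + v) + z * (suc σ + q)) + r * (r + v)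
                                                 ≤⟨ +-monoˡ-≤ (r * (r + v)) (+-monoʳ-≤ (2 + n * (q + v)) (*-monoˡ-≤ (suc σ + q) z≤q)) ⟩
    2 + (n * (q + v) + q * (suc σ + q)) + r * (r + v)
                                                 ≡⟨ balance m σ r v ⟨
    twiceEdgeBound T s m + slack                 ∎))
  where
  open ≤-Reasoning
  m s q T n slack : ℕ
  m = suc μ
  s = m + σ
  q = suc m + r
  T = 2 + m + 2 * r + v
  n = T + s + 2
  slack = (s + 2) * v + r * (2 * m + 2 * σ + 3)
  balance : ∀ m σ r v →
    (2 + m + 2 * r + v) * (1 + m + 2 * r + v) + 2 * ((m + σ + 2) * (m + 1)) + 2
      + ((m + σ + 2) * v + r * (2 * m + 2 * σ + 3))
    ≡ 2 + ((2 + m + 2 * r + v + (m + σ) + 2) * (suc m + r + v) + (suc m + r) * (suc σ + (suc m + r))) + r * (r + v)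
  balance = solve-∀
  room : 2 * m + 2 * σ + 3 ≤ r + v
  room = *-cancelˡ-≤ 2 (+-cancelˡ-≤ (2 + m) _ _ (begin
    2 + m + 2 * (2 * m + 2 * σ + 3)              ≤⟨ m≤m+n _ (6 * μ + 2 * σ) ⟩
    2 + m + 2 * (2 * m + 2 * σ + 3) + (6 * μ + 2 * σ)
                                                 ≡⟨ expand μ σ ⟩
    6 * s + 5 * m + 2                            ≤⟨ T≥ ⟩
    2 + m + 2 * r + v                            ≡⟨ +-assoc (2 + m) (2 * r) v ⟩
    2 + m + (2 * r + v)                          ≤⟨ +-monoʳ-≤ (2 + m) (widen r v) ⟩
    2 + m + 2 * (r + v)                          ∎))
    where
    expand : ∀ μ σ → 2 + suc μ + 2 * (2 * suc μ + 2 * σ + 3) + (6 * μ + 2 * σ) ≡ 6 * (suc μ + σ) + 5 * suc μ + 2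
    expand = solve-∀
    widen : ∀ r v → 2 * r + v ≤ 2 * (r + v)
    widen r v = subst (2 * r + v ≤_) (sym (*-distribˡ-+ 2 r v)) (+-monoʳ-≤ (2 * r) (m≤m+n v (v + 0)))

closure-level⇒T≡ : ∀ μ r v T → let m = suc μ ; q = suc m + r in
  suc (q + q) + v ≡ T + m + 1 → T ≡ 2 + m + 2 * r + v
closure-level⇒T≡ μ r v T eq =
  +-cancelʳ-≡ (suc μ + 1) T (2 + suc μ + 2 * r + v) (trans (sym (+-assoc T (suc μ) 1)) (trans (sym eq) (identity μ r v)))
  where
  identity : ∀ μ r v → suc (suc (suc μ) + r + (suc (suc μ) + r)) + v ≡ 2 + suc μ + 2 * r + v + (suc μ + 1)
  identity = solve-∀

high-threshold-bound : ∀ {m s T q v g x z E} → 1 ≤ m → m ≤ s → m < q → 6 * s + 5 * m + 2 ≤ T →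
  suc (q + q) + v ≡ T + m + 1 → m + g ≡ suc s → s + 2 ≤ x → z ≤ q →
  E + x * v ≤ (T + s + 2) * (q + v) + z * (g + q) → E < twiceEdgeBound T s m
high-threshold-bound {suc μ} {T = T} {v = v} {g} (s≤s z≤n) m≤s m<q T≥ 2q+1+v≡ m+g≡
  with m≤n⇒∃[o]m+o≡n m≤s | m≤n⇒∃[o]m+o≡n m<q
... | σ , refl | r , refl
  with +-cancelˡ-≡ (suc μ) g (suc σ) (trans m+g≡ (sym (+-suc (suc μ) σ))) | closure-level⇒T≡ μ r v T 2q+1+v≡
... | refl | refl = high-threshold-bound′ μ σ r v T≥

order-by-levels : ∀ {n T s m q v g} → n ≡ T + s + 2 → m + g ≡ suc s → suc (q + q) + v ≡ T + m + 1 →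
  n ≡ suc (q + v + (g + q))
order-by-levels {n} {T} {s} {m} {q} {v} {g} n≡ m+g≡ 2q+1+v≡ = begin
  n                      ≡⟨ n≡ ⟩
  T + s + 2              ≡⟨ regroup₁ T s ⟩
  T + suc s + 1          ≡⟨ cong (λ t → T + t + 1) m+g≡ ⟨
  T + (m + g) + 1        ≡⟨ regroup₂ T m g ⟩
  T + m + 1 + g          ≡⟨ cong (_+ g) 2q+1+v≡ ⟨
  suc (q + q) + v + g    ≡⟨ regroup₃ q v g ⟩
  suc (q + v + (g + q))  ∎
  where
  open ≡-Reasoning
  regroup₁ : ∀ T s → T + s + 2 ≡ T + suc s + 1
  regroup₁ = solve-∀
  regroup₂ : ∀ T m g → T + (m + g) + 1 ≡ T + m + 1 + g
  regroup₂ = solve-∀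
  regroup₃ : ∀ q v g → suc (q + q) + v + g ≡ suc (q + v + (g + q))
  regroup₃ = solve-∀

module _ {n m s T : ℕ} (H : Graph n) (1≤m : 1 ≤ m) (m≤s : m ≤ s) (n≡ : n ≡ T + s + 2)
         (T≥ : 6 * s + 5 * m + 2 ≤ T) (closed : Closed (T + m + 1) H) where

  private
    high : ℕ → Fin n → Bool
    high q = atLeast (suc q) (deg H)

    x+y≡ : ∀ q → count (not ∘ high q) + count (high q) ≡ T + s + 2
    x+y≡ q = trans (+-comm _ (count (high q))) (trans (count+count-not (high q)) n≡)

    all-at-0 : suc T ≤ count (atLeast 0 (deg H))
    all-at-0 = subst (suc T ≤_) (sym (trans (count-atLeast-0 (deg H)) n≡)) (≤-trans (n≤1+n (suc T))
                 (subst (_≤ T + s + 2) (+-comm T 2) (+-monoˡ-≤ 2 (m≤m+n T s))))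

    none-at-n : suc T ≰ count (atLeast n (deg H))
    none-at-n T<count = <⇒≱ (s≤s z≤n) (subst (suc T ≤_) (count-atLeast-≡0 (deg H) (deg<n H)) T<count)

  low-threshold⇒sparse : ∀ q → q ≤ m → count (high q) ≤ T → edges H + edges H < twiceEdgeBound T s m
  low-threshold⇒sparse q q≤m y≤T = low-threshold-bound q≤m 2m<T y≤T (x+y≡ q) (begin
    edges H + edges H              ≡⟨ handshake H ⟨
    sum (deg H)                    ≤⟨ ∑deg≤ H (high q) ⟩
    y * (y ∸ 1) + 2 * sumOver (not ∘ high q) (deg H)
                                   ≤⟨ +-monoʳ-≤ (y * (y ∸ 1)) (*-monoʳ-≤ 2 (sumOver-atMost (deg H) q)) ⟩
    y * (y ∸ 1) + 2 * (count (not ∘ high q) * q) ∎)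
    where
    open ≤-Reasoning
    y : ℕ
    y = count (high q)
    2m<T : 2 * m < T
    2m<T = <-≤-trans (m≤m+n (suc (2 * m)) (6 * s + 3 * m + 1)) (subst (_≤ T) (regroup m s) T≥)
      where
      regroup : ∀ m s → 6 * s + 5 * m + 2 ≡ suc (2 * m) + (6 * s + 3 * m + 1)
      regroup = solve-∀

  high-threshold⇒sparse : ∀ q w → deg H w ≡ q → m < q → count (high q) ≤ T → q + q < T + m + 1 →
    edges H + edges H < twiceEdgeBound T s m
  high-threshold⇒sparse q w dw≡q m<q y≤T 2q<l with m≤n⇒∃[o]m+o≡n 2q<l | m≤n⇒∃[o]m+o≡n (m≤n⇒m≤1+n m≤s)
  ... | v , 2q+1+v≡l | g , m+g≡ = high-threshold-bound 1≤m m≤s m<q T≥ 2q+1+v≡l m+g≡ s+2≤x z≤q (begin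
    edges H + edges H + x * v         ≡⟨ cong (_+ x * v) (handshake H) ⟨
    sum (deg H) + x * v               ≤⟨ ∑-three-levels (deg H) q v (g + q) deg≤ ⟩
    n * (q + v) + z * (g + q)         ≡⟨ cong (λ k → k * (q + v) + z * (g + q)) n≡ ⟩
    (T + s + 2) * (q + v) + z * (g + q) ∎)
    where
    open ≤-Reasoning
    x z : ℕ
    x = count (not ∘ high q)
    z = count (high (q + v))
    s+2≤x : s + 2 ≤ x
    s+2≤x = +-cancelʳ-≤ (count (high q)) (s + 2) x (begin
      s + 2 + count (high q)  ≤⟨ +-monoʳ-≤ (s + 2) y≤T ⟩
      s + 2 + T               ≡⟨ +-comm (s + 2) T ⟩
      T + (s + 2)             ≡⟨ +-assoc T s 2 ⟨
      T + s + 2               ≡⟨ x+y≡ q ⟨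
      x + count (high q)      ∎)
    z≤q : z ≤ q
    z≤q = subst (z ≤_) dw≡q (count-atLeast≤deg H closed w (suc (q + v)) l≤ (subst (_< suc (q + v)) (sym dw≡q) (s≤s (m≤m+n q v))))
      where
      l≤ : T + m + 1 ≤ deg H w + suc (q + v)
      l≤ = ≤-reflexive (trans (sym 2q+1+v≡l) (trans (regroup q v) (cong (_+ suc (q + v)) (sym dw≡q))))
        where
        regroup : ∀ q v → suc (q + q) + v ≡ q + suc (q + v)
        regroup = solve-∀
    deg≤ : ∀ u → deg H u ≤ q + v + (g + q)
    deg≤ u = ≤-pred (subst (deg H u <_) (order-by-levels {q = q} {v} {g} n≡ m+g≡ 2q+1+v≡l) (deg<n H u))

  dense⇒clique : twiceEdgeBound T s m ≤ edges H + edges H → CliqueNumberAtLeast H (suc T)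
  dense⇒clique dense with ∃-boundary (λ j → suc T ≤? count (atLeast j (deg H))) all-at-0 n none-at-n
  ... | q , T<count , T≮count with T + m + 1 ≤? q + q
  ...   | yes l≤2q = tabulate (atLeast q (deg H)) , atLeast-isClique H closed q l≤2q ,
                     subst (suc T ≤_) (sym (∣tabulate∣≡count (atLeast q (deg H)))) T<count
  ...   | no  l≰2q = ⊥-elim (<⇒≱ sparse dense)
    where
    y≤T : count (high q) ≤ T
    y≤T = ≤-pred (≰⇒> T≮count)
    2q<l : q + q < T + m + 1
    2q<l = ≰⇒> l≰2q
    sparse : edges H + edges H < twiceEdgeBound T s m
    sparse with q ≤? m | count-atLeast-drop⇒∃ (deg H) q (≤-<-trans y≤T T<count)
    ... | yes q≤m | _         = low-threshold⇒sparse q q≤m y≤T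
    ... | no  q≰m | w , dw≡q = high-threshold⇒sparse q w dw≡q (≰⇒> q≰m) y≤T 2q<l

twiceEdgeBound≡ : ∀ T k m →
  twiceEdgeBound T (suc k * m) m ≡ 2 * (T C 2 + suc k * (m * m) + (suc (suc k) + 1) * m + 3)
twiceEdgeBound≡ T k m = begin
  T * (T ∸ 1) + 2 * ((s + 2) * (m + 1)) + 2
    ≡⟨ cong (λ c → c + 2 * ((s + 2) * (m + 1)) + 2) (2*[nC2]≡n*[n∸1] T) ⟨
  2 * (T C 2) + 2 * ((s + 2) * (m + 1)) + 2
    ≡⟨ expand (T C 2) k m ⟩
  2 * (T C 2 + suc k * (m * m) + (suc (suc k) + 1) * m + 3) ∎
  where
  open ≡-Reasoning
  s : ℕ
  s = suc k * m
  expand : ∀ c k m → 2 * c + 2 * ((suc k * m + 2) * (m + 1)) + 2 ≡ 2 * (c + suc k * (m * m) + (suc (suc k) + 1) * m + 3)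
  expand = solve-∀

order-split : ∀ {n} s a → a + (s + 2) ≤ n → n ≡ n ∸ s ∸ 2 + s + 2 × a ≤ n ∸ s ∸ 2
order-split {n} s a room = n≡ , subst (a ≤_) (sym (∸-+-assoc n s 2)) (m+n≤o⇒m≤o∸n a room)
  where
  open ≡-Reasoning
  n≡ : n ≡ n ∸ s ∸ 2 + s + 2
  n≡ = begin
    n                          ≡⟨ m∸n+n≡m (m+n≤o⇒n≤o a room) ⟨
    n ∸ (s + 2) + (s + 2)      ≡⟨ cong (_+ (s + 2)) (∸-+-assoc n s 2) ⟨
    n ∸ s ∸ 2 + (s + 2)        ≡⟨ +-assoc (n ∸ s ∸ 2) s 2 ⟨
    n ∸ s ∸ 2 + s + 2          ∎

clique-order : ∀ {n T s} → n ≡ T + s + 2 → n ∸ s ∸ 1 ≡ suc T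
clique-order {T = T} {s} refl = cong (_∸ 1) (trans (cong (_∸ s) (regroup T s)) (m+n∸m≡n s (2 + T)))
  where
  regroup : ∀ T s → T + s + 2 ≡ s + (2 + T)
  regroup = solve-∀

closure-level : ∀ {n T s m} → n ≡ T + s + 2 → m ≤ T → n ∸ (m + s) + 2 * m ∸ 1 ≡ T + m + 1
closure-level {s = s} {m} refl m≤T with m≤n⇒∃[o]m+o≡n m≤T
... | t , refl = begin
  m + t + s + 2 ∸ (m + s) + 2 * m ∸ 1       ≡⟨ cong (λ x → x ∸ (m + s) + 2 * m ∸ 1) (regroup₁ m t s) ⟩
  (m + s) + (t + 2) ∸ (m + s) + 2 * m ∸ 1   ≡⟨ cong (λ x → x + 2 * m ∸ 1) (m+n∸m≡n (m + s) (t + 2)) ⟩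
  t + 2 + 2 * m ∸ 1                         ≡⟨ cong (_∸ 1) (regroup₂ m t) ⟩
  suc (m + t + m + 1) ∸ 1                   ∎
  where
  open ≡-Reasoning
  regroup₁ : ∀ m t s → m + t + s + 2 ≡ (m + s) + (t + 2)
  regroup₁ = solve-∀
  regroup₂ : ∀ m t → t + 2 + 2 * m ≡ suc (m + t + m + 1)
  regroup₂ = solve-∀

lemma3p1 : (m k n : ℕ) → 1 ≤ m → 2 ≤ k → (H : Graph n) →
    Connected m H →
    Closed (n ∸ k * m + 2 * m ∸ 1) H →
    (7 * k ∸ 2) * m + 4 ≤ n →
    ((n ∸ (k ∸ 1) * m ∸ 2) C 2) + (k ∸ 1) * (m * m) + (k + 1) * m + 3 ≤ edges H →
    CliqueNumberAtLeast H (n ∸ (k ∸ 1) * m ∸ 1)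
lemma3p1 m (suc (suc k)) n 1≤m (s≤s (s≤s z≤n)) H _ closed n-large dense =
  subst (CliqueNumberAtLeast H) (sym (clique-order n≡))
    (dense⇒clique H 1≤m (m≤m+n m (k * m)) n≡ T≥ (subst (λ l → Closed l H) (closure-level n≡ m≤T) closed) twice-dense)
  where
  s T : ℕ
  s = suc k * m
  T = n ∸ s ∸ 2
  -- The hypothesis (7k - 2)m + 4 ≤ n arrives with 7 (k + 2) ∸ 2 already reduced to k + 6 (k + 2).
  regroup : ∀ k m → (k + 6 * suc (suc k)) * m + 4 ≡ 6 * (suc k * m) + 5 * m + 2 + (suc k * m + 2)
  regroup = solve-∀
  split : n ≡ T + s + 2 × 6 * s + 5 * m + 2 ≤ T
  split = order-split s (6 * s + 5 * m + 2) (subst (_≤ n) (regroup k m) n-large)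
  n≡ : n ≡ T + s + 2
  n≡ = proj₁ split
  T≥ : 6 * s + 5 * m + 2 ≤ T
  T≥ = proj₂ split
  m≤T : m ≤ T
  m≤T = ≤-trans (≤-trans (m≤m+n m (4 * m)) (≤-trans (m≤n+m (5 * m) (6 * s)) (m≤m+n _ 2))) T≥
  twice-dense : twiceEdgeBound T s m ≤ edges H + edges H
  twice-dense = subst₂ _≤_ (sym (twiceEdgeBound≡ T k m)) (cong (edges H +_) (+-identityʳ (edges H))) (*-monoʳ-≤ 2 dense)
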